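{- Let $G$ be a triangle-free graph (simple, undirected, locally finite, without isolated vertices). Then \[ \operatorname{Ric}(G)\ge 4-\max\Bigl\{\frac{3d(x)+d(y)}{2}: x,y\in\mathcal{V}(G),\ \{x,y\}\in\mathcal{E}(G)\Bigr\}, \] the maximum being over all ordered pairs $(x,y)$ of adjacent vertices.
   Context: All graphs are undirected, simple, have no isolated vertices, and are locally finite; $d(x)$ is the degree of $x$ and $B(1,x)$ its set of neighbours. A graph is triangle-free if there are no three pairwise adjacent vertices. For real functions $f,g$ on $\mathcal{V}(G)$: $\Delta(f)(x)=\sum_{v\in B(1,x)}(f(v)-f(x))$, $\Gamma(f,g)(x)=\frac12\sum_{v\in B(1,x)}(f(x)-f(v))(g(x)-g(v))$, $\Gamma(f)=\Gamma(f,f)$, $\Gamma_2(f)(x)=\frac12\Delta(\Gamma(f,f))(x)-\Gamma(f,\Delta(f))(x)$. The Ricci curvature $\operatorname{Ric}(G)$ is the maximal $K\in\mathbb{R}\cup\{ -\infty\}$ such that $\Gamma_2(f)(x)\ge K\Gamma(f)(x)$ for every real function $f$ on $\mathcal{V}(G)$ and every vertex $x$.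
   Formalization: The test functions f in the definition of $\operatorname{Ric}(G)$ take values in ℚ rather than in the reals. -}

module Defs where

open import Data.Nat using (ℕ)
open import Data.List using (List; []; _∷_; length; map; foldr)
open import Data.List.Membership.Propositional using (_∈_; _∉_)
open import Data.List.Relation.Unary.Unique.Propositional using (Unique)
open import Data.Product using (_×_; Σ)
open import Relation.Nullary using (¬_)
open import Relation.Binary.PropositionalEquality using (_≡_)
open import Data.Rational using (ℚ; 0ℚ; _+_; _*_; _-_; ½; _/_; _≤_)
import Data.Integer as ℤ

-- A simple, undirected, locally finite graph without isolated vertices.
-- Each vertex x has a finite, duplicate-free list of neighbours B(1,x);
-- x ~ y  iff  y ∈ nbrs x.
record Graph : Set₁ where
  field
    V        : Set
    nbrs     : V → List V
    unique   : ∀ x → Unique (nbrs x)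
    symm     : ∀ {x y} → y ∈ nbrs x → x ∈ nbrs y
    irrefl   : ∀ x → x ∉ nbrs x
    noIsol   : ∀ x → ¬ (nbrs x ≡ [])

  deg : V → ℕ
  deg x = length (nbrs x)

open Graph public

TriangleFree : Graph → Set
TriangleFree G = ∀ x y z → ¬ (y ∈ nbrs G x × z ∈ nbrs G y × z ∈ nbrs G x)

sumℚ : List ℚ → ℚ
sumℚ = foldr _+_ 0ℚ

ℕtoℚ : ℕ → ℚ
ℕtoℚ n = ℤ.+ n / 1

module _ (G : Graph) where

  Δ : (V G → ℚ) → V G → ℚ
  Δ f x = sumℚ (map (λ v → f v - f x) (nbrs G x))

  Γ' : (V G → ℚ) → (V G → ℚ) → V G → ℚ
  Γ' f g x = ½ * sumℚ (map (λ v → (f x - f v) * (g x - g v)) (nbrs G x))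

  Γ : (V G → ℚ) → V G → ℚ
  Γ f = Γ' f f

  Γ₂ : (V G → ℚ) → V G → ℚ
  Γ₂ f x = ½ * Δ (Γ f) x - Γ' f (Δ f) x

  -- Ric(G) ≥ K : Γ₂(f)(x) ≥ K Γ(f)(x) for all f and x.
  -- (Ric(G) is the maximal such K; since Γ ≥ 0 the admissible K form a
  -- down-closed set, so "Ric(G) ≥ K" is exactly admissibility of K.)
  RicAtLeast : ℚ → Set
  RicAtLeast K = ∀ (f : V G → ℚ) (x : V G) → K * Γ f x ≤ Γ₂ f x

{-# OPTIONS --safe #-}
-- Write ∇v = f(x) − f(v) for the neighbours v of x, so that 2Γ(f)(x) = Σ_v ∇v².
-- Unfolding the definitions, 2Γ₂(f)(x) = Σ_v (Γf(v) + ∇v·Δf(v)) − d(x)Γf(x) + (Σ_v ∇v)².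
-- Completing the square, Γf(v) + ∇v·Δf(v) = ½Σ_{z∼v} (f(z) − f(v) + ∇v)² − ½d(v)∇v², and the
-- summand z = x alone is 2∇v².  Since x has a neighbour, (Σ_v ∇v)² ≥ (2 − d(x))Σ_v ∇v²
-- (equality for d(x) = 1, trivial otherwise).  Altogether
-- 2Γ₂(f)(x) ≥ Σ_v (4 − (3d(x) + d(v))/2)∇v², and each weight is at least 4 − M.
module Submission where

open import Defs
open import Data.List.Membership.Propositional using (_∈_)
open import Data.Rational using (ℚ; _≤_; _-_; _+_; _*_; ½)

open import Data.List using (List; []; _∷_; length; map)
open import Data.List.Relation.Unary.Any using (here; there)
open import Data.Nat using (suc)
open import Data.Rational using (0ℚ; 1ℚ; -_; mkℚ; _/_; nonNegative; nonPositive)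
open import Data.Rational.Properties
  using (_≟_; +-*-commutativeRing; module ≤-Reasoning; ≤-refl; ≤-reflexive; ≤-total; ↥p/↧p≡p;
         *-zeroˡ; *-zeroʳ; +-identityˡ; +-identityʳ; +-mono-≤; +-monoˡ-≤; +-monoʳ-≤;
         neg-antimono-≤; *-monoˡ-≤-nonNeg; *-monoʳ-≤-nonNeg; nonNegative⁻¹; normalize-nonNeg;
         nonNeg*nonNeg⇒nonNeg; nonPos*nonPos⇒nonPos)
open import Data.Sum using (inj₁; inj₂)
open import Function using (_∘_)
open import Level using (0ℓ)
open import Relation.Binary.PropositionalEquality
open import Relation.Nullary using (¬_; contradiction)
open import Relation.Nullary.Decidable using (dec⇒maybe)
import Data.Integer as ℤ
import Data.Integer.Properties as ℤ
import Data.Nat.Coprimality as Coprime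
open import Tactic.RingSolver using (solve-∀)
import Tactic.RingSolver.Core.AlmostCommutativeRing as ACR

ring : ACR.AlmostCommutativeRing 0ℓ 0ℓ
ring = ACR.fromCommutativeRing +-*-commutativeRing (λ q → dec⇒maybe (0ℚ ≟ q))

ℕtoℚ-suc : ∀ n → ℕtoℚ (suc n) ≡ 1ℚ + ℕtoℚ n
ℕtoℚ-suc n = begin
  ℤ.+ suc n / 1                       ≡⟨ cong (λ i → (ℤ.+ 1 ℤ.+ i) / 1) (sym (ℤ.*-identityʳ (ℤ.+ n))) ⟩
  1ℚ + n/1                            ≡⟨ cong (1ℚ +_) (sym (↥p/↧p≡p n/1)) ⟩
  1ℚ + ℕtoℚ n                         ∎
  where
  open ≡-Reasoning
  -- 1ℚ + n/1 unfolds to (+ 1 ℤ.+ + n ℤ.* + 1) / 1, which is stuck on n ℕ.* 1.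
  n/1 = mkℚ (ℤ.+ n) 0 (Coprime.sym (Coprime.1-coprimeTo n))

0≤ℕtoℚ : ∀ n → 0ℚ ≤ ℕtoℚ n
0≤ℕtoℚ n = nonNegative⁻¹ (ℕtoℚ n) {{normalize-nonNeg n 1}}

0≤p*q : ∀ {p q} → 0ℚ ≤ p → 0ℚ ≤ q → 0ℚ ≤ p * q
0≤p*q {p} {q} 0≤p 0≤q =
  nonNegative⁻¹ (p * q) {{nonNeg*nonNeg⇒nonNeg p {{nonNegative 0≤p}} q {{nonNegative 0≤q}}}}

0≤p*p : ∀ p → 0ℚ ≤ p * p
0≤p*p p with ≤-total 0ℚ p
... | inj₁ 0≤p = 0≤p*q 0≤p 0≤p
-- despite its name, nonPos*nonPos⇒nonPos concludes NonNegative
... | inj₂ p≤0 =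
  nonNegative⁻¹ (p * p) {{nonPos*nonPos⇒nonPos p {{nonPositive p≤0}} p {{nonPositive p≤0}}}}

∑ : {A : Set} → List A → (A → ℚ) → ℚ
∑ L g = sumℚ (map g L)

syntax ∑ L (λ v → e) = ∑[ v ∈ L ] e

module _ {A : Set} where

  ∑-cong : ∀ (L : List A) {g h : A → ℚ} → (∀ v → g v ≡ h v) → ∑ L g ≡ ∑ L h
  ∑-cong []      g≡h = refl
  ∑-cong (v ∷ L) g≡h = cong₂ _+_ (g≡h v) (∑-cong L g≡h)

  ∑-+ : ∀ (L : List A) (g h : A → ℚ) → ∑[ v ∈ L ] (g v + h v) ≡ ∑ L g + ∑ L h
  ∑-+ []      g h = refl
  ∑-+ (v ∷ L) g h = trans (cong (g v + h v +_) (∑-+ L g h)) (interchange (g v) (h v) (∑ L g) (∑ L h))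
    where
    interchange : ∀ a b c d → a + b + (c + d) ≡ a + c + (b + d)
    interchange = solve-∀ ring

  ∑-neg : ∀ (L : List A) (g : A → ℚ) → ∑[ v ∈ L ] (- g v) ≡ - ∑ L g
  ∑-neg []      g = refl
  ∑-neg (v ∷ L) g = trans (cong (- g v +_) (∑-neg L g)) (neg-+ (g v) (∑ L g))
    where
    neg-+ : ∀ a b → - a + - b ≡ - (a + b)
    neg-+ = solve-∀ ring

  ∑-- : ∀ (L : List A) (g h : A → ℚ) → ∑[ v ∈ L ] (g v - h v) ≡ ∑ L g - ∑ L h
  ∑-- L g h = trans (∑-+ L g (λ v → - h v)) (cong (∑ L g +_) (∑-neg L h))

  ∑-*ˡ : ∀ (L : List A) (k : ℚ) (g : A → ℚ) → ∑[ v ∈ L ] (k * g v) ≡ k * ∑ L g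
  ∑-*ˡ []      k g = sym (*-zeroʳ k)
  ∑-*ˡ (v ∷ L) k g = trans (cong (k * g v +_) (∑-*ˡ L k g)) (distrib k (g v) (∑ L g))
    where
    distrib : ∀ k a b → k * a + k * b ≡ k * (a + b)
    distrib = solve-∀ ring

  ∑-const : ∀ (L : List A) (c : ℚ) → ∑[ _ ∈ L ] c ≡ ℕtoℚ (length L) * c
  ∑-const []      c = sym (*-zeroˡ c)
  ∑-const (_ ∷ L) c = begin
    c + ∑[ _ ∈ L ] c              ≡⟨ cong (c +_) (∑-const L c) ⟩
    c + ℕtoℚ (length L) * c       ≡⟨ succ-* (ℕtoℚ (length L)) c ⟩
    (1ℚ + ℕtoℚ (length L)) * c    ≡⟨ cong (_* c) (sym (ℕtoℚ-suc (length L))) ⟩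
    ℕtoℚ (suc (length L)) * c     ∎
    where
    open ≡-Reasoning
    succ-* : ∀ n c → c + n * c ≡ (1ℚ + n) * c
    succ-* = solve-∀ ring

  ∑-mono-≤ : ∀ (L : List A) {g h : A → ℚ} → (∀ {v} → v ∈ L → g v ≤ h v) → ∑ L g ≤ ∑ L h
  ∑-mono-≤ []      g≤h = ≤-refl
  ∑-mono-≤ (v ∷ L) g≤h = +-mono-≤ (g≤h (here refl)) (∑-mono-≤ L (g≤h ∘ there))

  ∑-nonNeg : ∀ (L : List A) {g : A → ℚ} → (∀ {v} → v ∈ L → 0ℚ ≤ g v) → 0ℚ ≤ ∑ L g
  ∑-nonNeg []      0≤g = ≤-refl
  ∑-nonNeg (v ∷ L) 0≤g = +-mono-≤ (0≤g (here refl)) (∑-nonNeg L (0≤g ∘ there))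

  ∈⇒≤∑ : ∀ {L : List A} {g : A → ℚ} {z} → (∀ {v} → v ∈ L → 0ℚ ≤ g v) → z ∈ L → g z ≤ ∑ L g
  ∈⇒≤∑ {v ∷ L} {g} 0≤g (here refl) = begin
    g v            ≡⟨ sym (+-identityʳ (g v)) ⟩
    g v + 0ℚ       ≤⟨ +-monoʳ-≤ (g v) (∑-nonNeg L (0≤g ∘ there)) ⟩
    g v + ∑ L g    ∎
    where open ≤-Reasoning
  ∈⇒≤∑ {v ∷ L} {g} {z} 0≤g (there z∈L) = begin
    g z            ≡⟨ sym (+-identityˡ (g z)) ⟩
    0ℚ + g z       ≤⟨ +-mono-≤ (0≤g (here refl)) (∈⇒≤∑ (0≤g ∘ there) z∈L) ⟩
    g v + ∑ L g    ∎
    where open ≤-Reasoning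

  ∑²-lowerBound : ∀ (L : List A) (g : A → ℚ) → ¬ L ≡ [] →
                  (ℕtoℚ 2 - ℕtoℚ (length L)) * ∑[ v ∈ L ] (g v * g v) ≤ ∑ L g * ∑ L g
  ∑²-lowerBound []           g L≢[] = contradiction refl L≢[]
  ∑²-lowerBound (y ∷ [])     g _ = ≤-reflexive (single (g y))
    where
    single : ∀ a → (ℕtoℚ 2 - ℕtoℚ 1) * (a * a + 0ℚ) ≡ (a + 0ℚ) * (a + 0ℚ)
    single = solve-∀ ring
  ∑²-lowerBound (y ∷ y′ ∷ L) g _ = begin
    (ℕtoℚ 2 - ℕtoℚ (suc (suc n))) * S    ≡⟨ cong (λ m → (ℕtoℚ 2 - m) * S) 2+n≡ ⟩
    (ℕtoℚ 2 - (1ℚ + (1ℚ + ℕtoℚ n))) * S  ≡⟨ two-minus (ℕtoℚ n) S ⟩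
    - (ℕtoℚ n * S)                        ≤⟨ neg-antimono-≤ (0≤p*q (0≤ℕtoℚ n) 0≤S) ⟩
    0ℚ                                    ≤⟨ 0≤p*p T ⟩
    T * T                                 ∎
    where
    open ≤-Reasoning
    n = length L
    S = ∑[ v ∈ y ∷ y′ ∷ L ] (g v * g v)
    T = ∑ (y ∷ y′ ∷ L) g
    0≤S : 0ℚ ≤ S
    0≤S = ∑-nonNeg (y ∷ y′ ∷ L) λ {v} _ → 0≤p*p (g v)
    2+n≡ : ℕtoℚ (suc (suc n)) ≡ 1ℚ + (1ℚ + ℕtoℚ n)
    2+n≡ = trans (ℕtoℚ-suc (suc n)) (cong (1ℚ +_) (ℕtoℚ-suc n))
    two-minus : ∀ m s → (ℕtoℚ 2 - (1ℚ + (1ℚ + m))) * s ≡ - (m * s)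
    two-minus = solve-∀ ring

module _ (G : Graph) where

  ∇ : (V G → ℚ) → V G → V G → ℚ
  ∇ f x v = f x - f v

  Δ≡-∑∇ : ∀ f x → Δ G f x ≡ - ∑ (nbrs G x) (∇ f x)
  Δ≡-∑∇ f x = trans (∑-cong (nbrs G x) λ v → flip (f v) (f x)) (∑-neg (nbrs G x) (∇ f x))
    where
    flip : ∀ a b → a - b ≡ - (b - a)
    flip = solve-∀ ring

  Γ₂-expansion : ∀ f x →
    Γ₂ G f x ≡ ½ * ∑[ v ∈ nbrs G x ] (Γ G f v + ∇ f x v * Δ G f v)
               - ½ * (ℕtoℚ (deg G x) * Γ G f x)
               + ½ * (∑ (nbrs G x) (∇ f x) * ∑ (nbrs G x) (∇ f x))
  Γ₂-expansion f x = begin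
    Γ₂ G f x
      ≡⟨⟩
    ½ * ∑[ v ∈ N ] (Γ G f v - Γ G f x) - ½ * ∑[ v ∈ N ] (∇ f x v * (Δ G f x - Δ G f v))
      ≡⟨ cong₂ (λ a b → ½ * a - ½ * b) ΔΓ≡ Γ′≡ ⟩
    ½ * (∑ N (Γ G f) - d * Γ G f x) - ½ * (- T * T - R)
      ≡⟨ regroup (∑ N (Γ G f)) R d (Γ G f x) T ⟩
    ½ * (∑ N (Γ G f) + R) - ½ * (d * Γ G f x) + ½ * (T * T)
      ≡⟨ cong (λ a → ½ * a - ½ * (d * Γ G f x) + ½ * (T * T)) (sym (∑-+ N (Γ G f) _)) ⟩
    ½ * ∑[ v ∈ N ] (Γ G f v + ∇ f x v * Δ G f v) - ½ * (d * Γ G f x) + ½ * (T * T)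
      ∎
    where
    open ≡-Reasoning
    N = nbrs G x
    d = ℕtoℚ (deg G x)
    T = ∑ N (∇ f x)
    R = ∑[ v ∈ N ] (∇ f x v * Δ G f v)
    ΔΓ≡ : ∑[ v ∈ N ] (Γ G f v - Γ G f x) ≡ ∑ N (Γ G f) - d * Γ G f x
    ΔΓ≡ = trans (∑-- N (Γ G f) (λ _ → Γ G f x)) (cong (λ s → ∑ N (Γ G f) - s) (∑-const N (Γ G f x)))
    distrib : ∀ a p q → a * (p - q) ≡ p * a - a * q
    distrib = solve-∀ ring
    Γ′≡ : ∑[ v ∈ N ] (∇ f x v * (Δ G f x - Δ G f v)) ≡ - T * T - R
    Γ′≡ = begin
      ∑[ v ∈ N ] (∇ f x v * (Δ G f x - Δ G f v))
        ≡⟨ ∑-cong N (λ v → distrib (∇ f x v) (Δ G f x) (Δ G f v)) ⟩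
      ∑[ v ∈ N ] (Δ G f x * ∇ f x v - ∇ f x v * Δ G f v)
        ≡⟨ ∑-- N (λ v → Δ G f x * ∇ f x v) _ ⟩
      ∑[ v ∈ N ] (Δ G f x * ∇ f x v) - R
        ≡⟨ cong (_- R) (∑-*ˡ N (Δ G f x) (∇ f x)) ⟩
      Δ G f x * T - R
        ≡⟨ cong (λ a → a * T - R) (Δ≡-∑∇ f x) ⟩
      - T * T - R
        ∎
    regroup : ∀ S R d g T →
              ½ * (S - d * g) - ½ * (- T * T - R) ≡ ½ * (S + R) - ½ * (d * g) + ½ * (T * T)
    regroup = solve-∀ ring

  ∑squares≡Γ+cΔ : ∀ f v c →
    ∑[ z ∈ nbrs G v ] (½ * ((f z - f v + c) * (f z - f v + c)))
      ≡ Γ G f v + c * Δ G f v + ℕtoℚ (deg G v) * (½ * (c * c))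
  ∑squares≡Γ+cΔ f v c = begin
    ∑[ z ∈ N ] (½ * ((f z - f v + c) * (f z - f v + c)))
      ≡⟨ ∑-cong N (λ z → expand (f z) (f v) c) ⟩
    ∑[ z ∈ N ] (½ * ((f v - f z) * (f v - f z)) + c * (f z - f v) + ½ * (c * c))
      ≡⟨ trans (∑-+ N _ (λ _ → ½ * (c * c))) (cong (_+ ∑[ _ ∈ N ] (½ * (c * c))) (∑-+ N _ _)) ⟩
    ∑[ z ∈ N ] (½ * ((f v - f z) * (f v - f z))) + ∑[ z ∈ N ] (c * (f z - f v))
      + ∑[ _ ∈ N ] (½ * (c * c))
      ≡⟨ cong₂ _+_ (cong₂ _+_ (∑-*ˡ N ½ _) (∑-*ˡ N c _)) (∑-const N (½ * (c * c))) ⟩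
    Γ G f v + c * Δ G f v + ℕtoℚ (deg G v) * (½ * (c * c))
      ∎
    where
    open ≡-Reasoning
    N = nbrs G v
    expand : ∀ a b c →
             ½ * ((a - b + c) * (a - b + c)) ≡ ½ * ((b - a) * (b - a)) + c * (a - b) + ½ * (c * c)
    expand = solve-∀ ring

  Γ+∇Δ-lowerBound : ∀ f {x v} → v ∈ nbrs G x →
    (ℕtoℚ 2 - ½ * ℕtoℚ (deg G v)) * (∇ f x v * ∇ f x v) ≤ Γ G f v + ∇ f x v * Δ G f v
  Γ+∇Δ-lowerBound f {x} {v} v∈Nx = begin
    (ℕtoℚ 2 - ½ * dv) * (c * c)                      ≡⟨ rearrange (f x) (f v) dv ⟩
    square x - e                                     ≤⟨ +-monoˡ-≤ (- e) (∈⇒≤∑ (λ {z} _ → 0≤square z) x∈Nv) ⟩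
    ∑ (nbrs G v) square - e                          ≡⟨ cong (_- e) (∑squares≡Γ+cΔ f v c) ⟩
    Γ G f v + c * Δ G f v + e - e                    ≡⟨ cancel (Γ G f v + c * Δ G f v) e ⟩
    Γ G f v + c * Δ G f v                            ∎
    where
    open ≤-Reasoning
    c = ∇ f x v
    dv = ℕtoℚ (deg G v)
    e = dv * (½ * (c * c))
    x∈Nv : x ∈ nbrs G v
    x∈Nv = symm G v∈Nx
    square : V G → ℚ
    square z = ½ * ((f z - f v + c) * (f z - f v + c))
    0≤square : ∀ z → 0ℚ ≤ square z
    0≤square z = 0≤p*q (nonNegative⁻¹ ½) (0≤p*p (f z - f v + c))
    rearrange : ∀ a b d → (ℕtoℚ 2 - ½ * d) * ((a - b) * (a - b))
                          ≡ ½ * ((a - b + (a - b)) * (a - b + (a - b))) - d * (½ * ((a - b) * (a - b)))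
    rearrange = solve-∀ ring
    cancel : ∀ p q → p + q - q ≡ p
    cancel = solve-∀ ring

  Γ₂-lowerBound : ∀ f x →
    ½ * ∑[ v ∈ nbrs G x ]
          ((ℕtoℚ 4 - ½ * (ℕtoℚ 3 * ℕtoℚ (deg G x) + ℕtoℚ (deg G v))) * (∇ f x v * ∇ f x v))
      ≤ Γ₂ G f x
  Γ₂-lowerBound f x = begin
    ½ * ∑[ v ∈ N ] ((ℕtoℚ 4 - ½ * (ℕtoℚ 3 * d + dv v)) * sq v)
      ≡⟨ cong (½ *_) (∑-cong N λ v → split d (dv v) (sq v)) ⟩
    ½ * ∑[ v ∈ N ] ((ℕtoℚ 2 - ½ * dv v) * sq v + a * sq v)
      ≡⟨ cong (½ *_) (trans (∑-+ N _ _) (cong (A +_) (∑-*ˡ N a sq))) ⟩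
    ½ * (A + a * B)
      ≡⟨ regroup A B d ⟩
    ½ * A - ½ * (d * (½ * B)) + ½ * ((ℕtoℚ 2 - d) * B)
      ≤⟨ +-mono-≤ (+-monoˡ-≤ _ (*-monoˡ-≤-nonNeg ½ (∑-mono-≤ N (Γ+∇Δ-lowerBound f))))
                  (*-monoˡ-≤-nonNeg ½ (∑²-lowerBound N (∇ f x) (noIsol G x))) ⟩
    ½ * ∑[ v ∈ N ] (Γ G f v + ∇ f x v * Δ G f v) - ½ * (d * Γ G f x) + ½ * (T * T)
      ≡⟨ sym (Γ₂-expansion f x) ⟩
    Γ₂ G f x
      ∎
    where
    open ≤-Reasoning
    N = nbrs G x
    d = ℕtoℚ (deg G x)
    dv : V G → ℚ
    dv v = ℕtoℚ (deg G v)
    sq : V G → ℚ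
    sq v = ∇ f x v * ∇ f x v
    a = ℕtoℚ 2 - ½ * (ℕtoℚ 3 * d)
    A = ∑[ v ∈ N ] ((ℕtoℚ 2 - ½ * dv v) * sq v)
    B = ∑ N sq
    T = ∑ N (∇ f x)
    split : ∀ d e s → (ℕtoℚ 4 - ½ * (ℕtoℚ 3 * d + e)) * s
                      ≡ (ℕtoℚ 2 - ½ * e) * s + (ℕtoℚ 2 - ½ * (ℕtoℚ 3 * d)) * s
    split = solve-∀ ring
    regroup : ∀ A B d → ½ * (A + (ℕtoℚ 2 - ½ * (ℕtoℚ 3 * d)) * B)
                        ≡ ½ * A - ½ * (d * (½ * B)) + ½ * ((ℕtoℚ 2 - d) * B)
    regroup = solve-∀ ring

mainTheorem4 : (G : Graph) → TriangleFree G → (M : ℚ)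
               → (∀ x y → y ∈ nbrs G x → ½ * (ℕtoℚ 3 * ℕtoℚ (deg G x) + ℕtoℚ (deg G y)) ≤ M)
               → RicAtLeast G (ℕtoℚ 4 - M)
mainTheorem4 G _ M weight≤M f x = begin
  K * Γ G f x                                  ≡⟨ trans (swap K B) (cong (½ *_) (sym (∑-*ˡ N K sq))) ⟩
  ½ * ∑[ v ∈ N ] (K * sq v)                    ≤⟨ *-monoˡ-≤-nonNeg ½ (∑-mono-≤ N K≤4-weight) ⟩
  ½ * ∑[ v ∈ N ] ((ℕtoℚ 4 - weight v) * sq v)  ≤⟨ Γ₂-lowerBound G f x ⟩
  Γ₂ G f x                                     ∎
  where
  open ≤-Reasoning
  K = ℕtoℚ 4 - M
  N = nbrs G x
  weight : V G → ℚ
  weight v = ½ * (ℕtoℚ 3 * ℕtoℚ (deg G x) + ℕtoℚ (deg G v))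
  sq : V G → ℚ
  sq v = ∇ G f x v * ∇ G f x v
  B = ∑ N sq
  K≤4-weight : ∀ {v} → v ∈ N → K * sq v ≤ (ℕtoℚ 4 - weight v) * sq v
  K≤4-weight {v} v∈N = *-monoʳ-≤-nonNeg (sq v) {{nonNegative (0≤p*p (∇ G f x v))}}
                       (+-monoʳ-≤ (ℕtoℚ 4) (neg-antimono-≤ (weight≤M x v v∈N)))
  swap : ∀ k b → k * (½ * b) ≡ ½ * (k * b)
  swap = solve-∀ ring
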